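{- Every unsplittable combinatorial configuration is both point-unsplittable and line-unsplittable. Moreover, there exist splittable combinatorial configurations that are both point-unsplittable and line-unsplittable.
   Context: A combinatorial $(v_k)$ configuration is a triple $\mathcal{C}=(\mathcal{P},\mathcal{B},\mathcal{I})$ of points $\mathcal{P}$, lines $\mathcal{B}$ and an incidence relation $\mathcal{I}\subseteq\mathcal{P}\times\mathcal{B}$, with $\mathcal{P}\cap\mathcal{B}=\emptyset$ and $|\mathcal{P}|=|\mathcal{B}|=v$. Each line has exactly $k$ points, each point lies on exactly $k$ lines, and two distinct points lie on at most one common line. The Levi graph $L(\mathcal{C})$ is the bipartite point–line incidence graph. The square $G^2$ of a graph $G$ joins two distinct vertices iff their distance in $G$ is at most 2. A splitting set is a set $\Sigma$ of elements that is independent in $L(\mathcal{C})^2$ and such that $L(\mathcal{C})-\Sigma$ is disconnected. $\mathcal{C}$ is splittable if a splitting set exists and unsplittable otherwise. It is point-splittable (resp. line-splittable) if some splitting set consists only of points (resp. only of lines), and point-unsplittable (resp. line-unsplittable) otherwise. -}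

module Defs where

open import Data.Nat using (ℕ; zero; suc; _+_)
open import Data.Fin using (Fin; zero; suc)
open import Data.Bool using (Bool; true; false; T)
open import Data.Sum using (_⊎_; inj₁; inj₂)
open import Data.Product using (Σ; ∃; ∃-syntax; _×_; _,_)
open import Data.Empty using (⊥)
open import Data.Unit using (⊤)
open import Relation.Nullary using (¬_)
open import Relation.Binary.PropositionalEquality using (_≡_; _≢_)

count : {n : ℕ} → (Fin n → Bool) → ℕ
count {zero}  f = 0
count {suc n} f with f zero
... | true  = suc (count (λ i → f (suc i)))
... | false = count (λ i → f (suc i))

-- A combinatorial (v_k) configuration, points and lines both indexed by Fin v
-- (disjoint as the two summands of Elem v).  inc p l = true iff p I l.
record Config (v k : ℕ) : Set where
  field
    inc        : Fin v → Fin v → Bool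
    lineSize   : ∀ (l : Fin v) → count (λ p → inc p l) ≡ k
    pointDeg   : ∀ (p : Fin v) → count (λ l → inc p l) ≡ k
    atMostOne  : ∀ (p q l m : Fin v) → p ≢ q →
                 T (inc p l) → T (inc q l) → T (inc p m) → T (inc q m) → l ≡ m

-- elements of the configuration = vertices of the Levi graph
data Elem (v : ℕ) : Set where
  pt : Fin v → Elem v
  ln : Fin v → Elem v

IsPoint : {v : ℕ} → Elem v → Set
IsPoint (pt _) = ⊤
IsPoint (ln _) = ⊥

IsLine : {v : ℕ} → Elem v → Set
IsLine (pt _) = ⊥
IsLine (ln _) = ⊤

module _ {v k : ℕ} (C : Config v k) where
  open Config C

  Adj : Elem v → Elem v → Set
  Adj (pt p) (ln l) = T (inc p l)
  Adj (ln l) (pt p) = T (inc p l)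
  Adj (pt _) (pt _) = ⊥
  Adj (ln _) (ln _) = ⊥

  Adj² : Elem v → Elem v → Set
  Adj² x y = x ≢ y × (Adj x y ⊎ (∃[ z ] (Adj x z × Adj z y)))

  ElemSet : Set
  ElemSet = Elem v → Bool

  IndependentInSquare : ElemSet → Set
  IndependentInSquare S = ∀ x y → T (S x) → T (S y) → ¬ Adj² x y

  data Reach (S : ElemSet) : Elem v → Elem v → Set where
    here : ∀ {x} → ¬ T (S x) → Reach S x x
    step : ∀ {x y z} → Reach S x y → Adj y z → ¬ T (S z) → Reach S x z

  DisconnectedWithout : ElemSet → Set
  DisconnectedWithout S =
    ∃[ x ] ∃[ y ] (¬ T (S x) × ¬ T (S y) × ¬ Reach S x y)

  SplittingSet : ElemSet → Set
  SplittingSet S = IndependentInSquare S × DisconnectedWithout S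

  Splittable : Set
  Splittable = ∃[ S ] SplittingSet S

  Unsplittable : Set
  Unsplittable = ¬ Splittable

  PointSplittable : Set
  PointSplittable = ∃[ S ] (SplittingSet S × (∀ x → T (S x) → IsPoint x))

  LineSplittable : Set
  LineSplittable = ∃[ S ] (SplittingSet S × (∀ x → T (S x) → IsLine x))

  PointUnsplittable : Set
  PointUnsplittable = ¬ PointSplittable

  LineUnsplittable : Set
  LineUnsplittable = ¬ LineSplittable

module Submission where

-- (1) A splitting set consisting only of points (or only of lines) is in
--     particular a splitting set, so an unsplittable configuration is both
--     point- and line-unsplittable.
--
-- (2) The triangle, the (3_2) configuration whose Levi graph is a 6-cycle,
--     is splittable but neither point- nor line-splittable.  Two opposite
--     vertices of the 6-cycle (a point and the line not through it) form a
--     splitting set.  Any two points of the triangle are collinear, so a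
--     square-independent set of points has at most one element; removing it
--     leaves every line reachable from every other, hence L(C) − S
--     connected.  The triangle is self-dual, and splitting sets pull back
--     along Levi-graph automorphisms, so line-unsplittability follows from
--     point-unsplittability.

open import Defs
open import Data.Nat using (ℕ)
open import Data.Fin using (Fin; zero; suc)
open import Data.Fin.Properties using (_≟_; all?; any?)
open import Data.Bool using (Bool; true; false; T)
open import Data.Bool.Properties using (T?)
open import Data.Product using (Σ; ∃-syntax; _×_; _,_)
open import Data.Sum using (_⊎_; inj₁; inj₂)
open import Data.Empty using (⊥; ⊥-elim)
open import Data.Unit using (⊤; tt)
open import Relation.Nullary using (¬_; yes; no; ¬?)
open import Relation.Nullary.Decidable using (⌊_⌋; from-yes; fromWitness; toWitness; _×-dec_; _→-dec_)
open import Relation.Binary.PropositionalEquality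
  using (_≡_; _≢_; refl; sym; trans; cong; subst; subst₂; ≢-sym)

module _ {v k : ℕ} {C : Config v k} {S : ElemSet C} where

  adj-sym : ∀ x y → Adj C x y → Adj C y x
  adj-sym (pt _) (ln _) a = a
  adj-sym (ln _) (pt _) a = a

  reach-source-outside : ∀ {x y} → Reach C S x y → ¬ T (S x)
  reach-source-outside (here x∉S)   = x∉S
  reach-source-outside (step r _ _) = reach-source-outside r

  reach-target-outside : ∀ {x y} → Reach C S x y → ¬ T (S y)
  reach-target-outside (here y∉S)     = y∉S
  reach-target-outside (step _ _ y∉S) = y∉S

  reach-trans : ∀ {x y z} → Reach C S x y → Reach C S y z → Reach C S x z
  reach-trans r (here _)       = r
  reach-trans r (step r′ a z∉S) = step (reach-trans r r′) a z∉S

  reach-sym : ∀ {x y} → Reach C S x y → Reach C S y x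
  reach-sym (here x∉S) = here x∉S
  reach-sym (step {y = y} {z = z} r a z∉S) =
    reach-trans (step (here z∉S) (adj-sym y z a) (reach-target-outside r))
                (reach-sym r)

  reach-invariant : (P : Elem v → Set) →
                    (∀ y z → P y → Adj C y z → ¬ T (S z) → P z) →
                    ∀ {x y} → Reach C S x y → P x → P y
  reach-invariant P closed (here _)                        Px = Px
  reach-invariant P closed (step {y = y} {z = z} r a z∉S) Px =
    closed y z (reach-invariant P closed r Px) a z∉S

  connected-via-hub : (h : Elem v) → (∀ y → ¬ T (S y) → Reach C S h y) →
                      ¬ DisconnectedWithout C S
  connected-via-hub h hub (x , y , x∉S , y∉S , x↛y) =
    x↛y (reach-trans (reach-sym (hub x x∉S)) (hub y y∉S))

  collinear-points-exclusive :
    IndependentInSquare C S → ∀ {p q l} → p ≢ q →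
    Adj C (pt p) (ln l) → Adj C (ln l) (pt q) →
    T (S (pt p)) → ¬ T (S (pt q))
  collinear-points-exclusive ind {p} {q} {l} p≢q p∈l q∈l p∈S q∈S =
    ind (pt p) (pt q) p∈S q∈S (pt≢pt , inj₂ (ln l , p∈l , q∈l))
    where
    pt≢pt : pt p ≢ pt q
    pt≢pt refl = p≢q refl

restricted-splittable : ∀ {v k} {C : Config v k} (P : ElemSet C → Set) →
                        ∃[ S ] (SplittingSet C S × P S) → Splittable C
restricted-splittable P (S , splitting , _) = S , splitting

unsplittable⇒point-and-line-unsplittable :
  ∀ {v k} (C : Config v k) →
  Unsplittable C → PointUnsplittable C × LineUnsplittable C
unsplittable⇒point-and-line-unsplittable C unsplittable =
    (λ split → unsplittable (restricted-splittable _ split))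
  , (λ split → unsplittable (restricted-splittable _ split))

-- Splitting sets pull back along automorphisms of the Levi graph, here
-- given as adjacency-preserving involutions (e.g. a self-duality).

module _ {v k : ℕ} (C : Config v k) (σ : Elem v → Elem v)
         (σ-involutive : ∀ x → σ (σ x) ≡ x)
         (σ-adj : ∀ x y → Adj C x y → Adj C (σ x) (σ y)) where

  pullback : ElemSet C → ElemSet C
  pullback S x = S (σ x)

  reach-push : ∀ {S x y} → Reach C (pullback S) x y → Reach C S (σ x) (σ y)
  reach-push (here x∉S) = here x∉S
  reach-push (step {y = y} {z = z} r a z∉S) = step (reach-push r) (σ-adj y z a) z∉S

  σ-injective : ∀ {x y} → σ x ≡ σ y → x ≡ y
  σ-injective {x} {y} eq =
    trans (sym (σ-involutive x)) (trans (cong σ eq) (σ-involutive y))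

  splitting-pullback : ∀ {S} → SplittingSet C S → SplittingSet C (pullback S)
  splitting-pullback {S} (ind , x , y , x∉S , y∉S , x↛y) =
    ind′ , σ x , σ y , outside x x∉S , outside y y∉S , x↛y′
    where
    ind′ : IndependentInSquare C (pullback S)
    ind′ a b a∈S b∈S (a≢b , d) =
      ind (σ a) (σ b) a∈S b∈S ((λ eq → a≢b (σ-injective eq)) , push d)
      where
      push : Adj C a b ⊎ ∃[ c ] (Adj C a c × Adj C c b) →
             Adj C (σ a) (σ b) ⊎ ∃[ c ] (Adj C (σ a) c × Adj C c (σ b))
      push (inj₁ e)           = inj₁ (σ-adj a b e)
      push (inj₂ (c , e , f)) = inj₂ (σ c , σ-adj a c e , σ-adj c b f)

    outside : ∀ z → ¬ T (S z) → ¬ T (pullback S (σ z))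
    outside z z∉S = subst (λ w → ¬ T (S w)) (sym (σ-involutive z)) z∉S

    x↛y′ : ¬ Reach C (pullback S) (σ x) (σ y)
    x↛y′ r = x↛y (subst₂ (Reach C S) (σ-involutive x) (σ-involutive y)
                                       (reach-push r))

third-unique : ∀ (p q l m : Fin 3) →
               p ≢ q → l ≢ p → l ≢ q → m ≢ p → m ≢ q → l ≡ m
third-unique = from-yes
  (all? {3} λ p → all? {3} λ q → all? {3} λ l → all? {3} λ m →
    ¬? (p ≟ q) →-dec ¬? (l ≟ p) →-dec ¬? (l ≟ q) →-dec
    ¬? (m ≟ p) →-dec ¬? (m ≟ q) →-dec (l ≟ m))

third-exists : ∀ (p q : Fin 3) → ∃[ r ] (r ≢ p × r ≢ q)
third-exists = from-yes
  (all? {3} λ p → all? {3} λ q → any? {3} λ r → ¬? (r ≟ p) ×-dec ¬? (r ≟ q))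

-- The triangle: points and lines are indexed by Fin 3, and line l consists
-- of the two points different from l.

triangle-inc : Fin 3 → Fin 3 → Bool
triangle-inc p l = ⌊ ¬? (p ≟ l) ⌋

on-line : ∀ {p l} → p ≢ l → T (triangle-inc p l)
on-line {p} {l} p≢l = fromWitness {a? = ¬? (p ≟ l)} p≢l

on-line⁻¹ : ∀ {p l} → T (triangle-inc p l) → p ≢ l
on-line⁻¹ {p} {l} = toWitness {a? = ¬? (p ≟ l)}

-- Incidence is symmetric in its two indices, which makes the triangle
-- self-dual.
triangle-inc-sym : ∀ p l → triangle-inc p l ≡ triangle-inc l p
triangle-inc-sym p l with p ≟ l | l ≟ p
... | yes _   | yes _   = refl
... | no _    | no _    = refl
... | yes p≡l | no l≢p  = ⊥-elim (l≢p (sym p≡l))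
... | no p≢l  | yes l≡p = ⊥-elim (p≢l (sym l≡p))

-- Two distinct points lie on at most one common line: that line is the
-- unique third element of Fin 3.
triangle-at-most-one : ∀ (p q l m : Fin 3) → p ≢ q →
  T (triangle-inc p l) → T (triangle-inc q l) →
  T (triangle-inc p m) → T (triangle-inc q m) → l ≡ m
triangle-at-most-one p q l m p≢q p∈l q∈l p∈m q∈m =
  third-unique p q l m p≢q
    (≢-sym (on-line⁻¹ p∈l)) (≢-sym (on-line⁻¹ q∈l))
    (≢-sym (on-line⁻¹ p∈m)) (≢-sym (on-line⁻¹ q∈m))

Triangle : Config 3 2
Triangle = record
  { inc       = triangle-inc
  ; lineSize  = λ { zero → refl ; (suc zero) → refl ; (suc (suc zero)) → refl }
  ; pointDeg  = λ { zero → refl ; (suc zero) → refl ; (suc (suc zero)) → refl }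
  ; atMostOne = triangle-at-most-one
  }

-- The triangle is splittable: removing the point 0 and the line 0 (which
-- are at distance 3) separates {line 1, point 2} from {point 1, line 2}.

opposite-pair : ElemSet Triangle
opposite-pair (pt zero) = true
opposite-pair (ln zero) = true
opposite-pair _         = false

-- Point 0 is not on line 0, and a point and a line have no common neighbour.
opposite-pair-independent : IndependentInSquare Triangle opposite-pair
opposite-pair-independent (pt zero) (pt zero) _ _ (x≢x , _) = x≢x refl
opposite-pair-independent (ln zero) (ln zero) _ _ (x≢x , _) = x≢x refl
opposite-pair-independent (pt zero) (ln zero) _ _ (_ , inj₁ ())
opposite-pair-independent (pt zero) (ln zero) _ _ (_ , inj₂ (pt _ , () , _))
opposite-pair-independent (pt zero) (ln zero) _ _ (_ , inj₂ (ln _ , _ , ()))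
opposite-pair-independent (ln zero) (pt zero) _ _ (_ , inj₁ ())
opposite-pair-independent (ln zero) (pt zero) _ _ (_ , inj₂ (pt _ , _ , ()))
opposite-pair-independent (ln zero) (pt zero) _ _ (_ , inj₂ (ln _ , () , _))

component-of-line1 : Elem 3 → Set
component-of-line1 (ln (suc zero))       = ⊤
component-of-line1 (pt (suc (suc zero))) = ⊤
component-of-line1 _                     = ⊥

component-closed : ∀ y z → component-of-line1 y → Adj Triangle y z →
                   ¬ T (opposite-pair z) → component-of-line1 z
component-closed (ln (suc zero)) (pt zero) _ _ z∉S = ⊥-elim (z∉S tt)
component-closed (ln (suc zero)) (pt (suc zero)) _ () _
component-closed (ln (suc zero)) (pt (suc (suc zero))) _ _ _ = tt
component-closed (pt (suc (suc zero))) (ln zero) _ _ z∉S = ⊥-elim (z∉S tt)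
component-closed (pt (suc (suc zero))) (ln (suc zero)) _ _ _ = tt
component-closed (pt (suc (suc zero))) (ln (suc (suc zero))) _ () _

opposite-pair-disconnects : DisconnectedWithout Triangle opposite-pair
opposite-pair-disconnects =
  ln (suc zero) , ln (suc (suc zero)) , (λ ()) , (λ ()) ,
  λ r → reach-invariant component-of-line1 component-closed r tt

module _ {S : ElemSet Triangle} (ind : IndependentInSquare Triangle S)
         (points-only : ∀ x → T (S x) → IsPoint x) where

  line-outside : ∀ l → ¬ T (S (ln l))
  line-outside l = points-only (ln l)

  -- Any two points are collinear, so S contains at most one point.
  points-exclusive : ∀ {p q} → p ≢ q → T (S (pt p)) → ¬ T (S (pt q))
  points-exclusive {p} {q} p≢q with third-exists p q
  ... | l , l≢p , l≢q =
    collinear-points-exclusive ind p≢q (on-line (≢-sym l≢p)) (on-line (≢-sym l≢q))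

  -- Lines l ≢ m meet in the third point r; if r ∈ S, go round the other way
  -- through point m, line r and point l.
  lines-connected : ∀ l m → Reach Triangle S (ln l) (ln m)
  lines-connected l m with l ≟ m
  ... | yes refl = here (line-outside l)
  ... | no l≢m with third-exists l m
  ...   | r , r≢l , r≢m with T? (S (pt r))
  ...     | no r∉S =
    step (step (here (line-outside l)) (on-line r≢l) r∉S)
         (on-line r≢m) (line-outside m)
  ...     | yes r∈S =
    step (step (step (step (here (line-outside l))
      (on-line (≢-sym l≢m)) (points-exclusive r≢m r∈S))
      (on-line (≢-sym r≢m)) (line-outside r))
      (on-line (≢-sym r≢l)) (points-exclusive r≢l r∈S))
      (on-line l≢m) (line-outside m)

  -- Line 0 reaches every vertex outside S; a point is entered from any
  -- line through it.
  reached-from-line0 : ∀ y → ¬ T (S y) → Reach Triangle S (ln zero) y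
  reached-from-line0 (ln l) _ = lines-connected zero l
  reached-from-line0 (pt p) p∉S with third-exists p p
  ... | l , l≢p , _ = step (lines-connected zero l) (on-line (≢-sym l≢p)) p∉S

triangle-point-unsplittable : PointUnsplittable Triangle
triangle-point-unsplittable (S , (ind , disconnected) , points-only) =
  connected-via-hub (ln zero) (reached-from-line0 ind points-only) disconnected

dual : Elem 3 → Elem 3
dual (pt i) = ln i
dual (ln i) = pt i

dual-involutive : ∀ x → dual (dual x) ≡ x
dual-involutive (pt _) = refl
dual-involutive (ln _) = refl

dual-adj : ∀ x y → Adj Triangle x y → Adj Triangle (dual x) (dual y)
dual-adj (pt p) (ln l) a = subst T (triangle-inc-sym p l) a
dual-adj (ln l) (pt p) a = subst T (triangle-inc-sym p l) a

dual-of-line : ∀ x → IsLine (dual x) → IsPoint x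
dual-of-line (pt _) _ = tt

triangle-line-unsplittable : LineUnsplittable Triangle
triangle-line-unsplittable (S , splitting , lines-only) =
  triangle-point-unsplittable
    ( pullback Triangle dual dual-involutive dual-adj S
    , splitting-pullback Triangle dual dual-involutive dual-adj splitting
    , λ x x∈S → dual-of-line x (lines-only (dual x) x∈S) )

proposition4 :
    (∀ (v k : ℕ) (C : Config v k) →
       Unsplittable C → PointUnsplittable C × LineUnsplittable C)
    × (∃[ v ] ∃[ k ] Σ (Config v k) λ C →
         Splittable C × PointUnsplittable C × LineUnsplittable C)
proposition4 =
    (λ v k → unsplittable⇒point-and-line-unsplittable)
  , 3 , 2 , Triangle
  , (opposite-pair , opposite-pair-independent , opposite-pair-disconnects)
  , triangle-point-unsplittable
  , triangle-line-unsplittable
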